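{- Consider augmentations $\mathfrak q, \mathfrak p$ on $A$ with an isomorphism of configurations $\varphi : D(\mathfrak q)\cong D(\mathfrak p)$. Consider $a\in|\mathfrak q|$, $b\in|\mathfrak p|$ and $\Gamma$ a context such that $a\sim_\Gamma^\varphi b$. Then $a$ and $b$ have the same co-depth.
   Context: $A$ well-opened arena; $\prec$ denotes immediate causality in any order. Augmentation $\mathfrak q$: events $|\mathfrak q|$, configuration $D(\mathfrak q)=(|\mathfrak q|,\le_{D(\mathfrak q)},\partial_{\mathfrak q})$, tree order $\le_{\mathfrak q}$, rule-abiding, courteous, deterministic; $\mathrm{just}(a)$ is the unique $a''\prec_{D(\mathfrak q)}a$. The co-depth of $a\in|\mathfrak q|$ is the maximal length $k$ of a causal chain $a=a_1\prec_{\mathfrak q}\dots\prec_{\mathfrak q}a_k$. Context $\Gamma$: display-preserving bijection from negative events of $\mathfrak q$ to events of $\mathfrak p$; $\Gamma\vdash(a,b)$: no element of $\mathrm{dom}(\Gamma)$ strictly above $a$, none of $\mathrm{cod}(\Gamma)$ strictly above $b$. $a\sim^\varphi_\Gamma b$ holds inductively if: (a) equal displays and $\Gamma\vdash(a,b)$; (b) $a$ positive, $\mathrm{just}(a)\in\mathrm{dom}(\Gamma)$ $\Rightarrow$ $\Gamma(\mathrm{just}(a))=\mathrm{just}(b)$; (c) $a$ positive, $\mathrm{just}(a)\notin\mathrm{dom}(\Gamma)$ $\Rightarrow$ $\mathrm{just}(b)\notin\mathrm{cod}(\Gamma)$ and $\varphi(\mathrm{just}(a))=\mathrm{just}(b)$;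 (1) $a$ positive: each $a\prec a'$ matched by $b\prec b'$ with $a'\sim^\varphi_{\Gamma\cup\{(a',b')\}}b'$, and symmetrically; (2) $a$ negative: each $a\prec a'$ matched by $b\prec b'$ with $a'\sim^\varphi_\Gamma b'$, and symmetrically. -}

module Defs where

open import Level using (0ℓ)
open import Data.Nat using (ℕ; zero; suc; _≤_)
open import Data.Fin using (Fin)
open import Data.List using (List; _∷_)
open import Data.List.Membership.Propositional using (_∈_)
open import Data.List.Relation.Unary.Any using (Any)
open import Data.Product using (Σ; ∃; _×_; _,_; proj₁; proj₂)
open import Data.Sum using (_⊎_)
open import Relation.Nullary using (¬_)
open import Relation.Binary using (Rel; IsPartialOrder)
open import Relation.Binary.PropositionalEquality using (_≡_; _≢_)

module _ {X : Set} (_≤_ : Rel X 0ℓ) where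
  Lt : X → X → Set
  Lt x y = x ≤ y × x ≢ y

  Imm : X → X → Set
  Imm x y = Lt x y × (∀ z → x ≤ z → z ≤ y → z ≡ x ⊎ z ≡ y)

  Minimal : X → Set
  Minimal x = ∀ y → y ≤ x → y ≡ x

  Forestial : Set
  Forestial = ∀ x y z → x ≤ z → y ≤ z → x ≤ y ⊎ y ≤ x

data Pol : Set where
  pos neg : Pol

record Arena : Set₁ where
  field
    M           : Set
    _≤A_        : Rel M 0ℓ
    isPO        : IsPartialOrder _≡_ _≤A_
    pol         : M → Pol
    finitary    : ∀ a → Σ (List M) λ l → ∀ a' → a' ≤A a → a' ∈ l
    forest      : Forestial _≤A_
    alternating : ∀ a₁ a₂ → Imm _≤A_ a₁ a₂ → pol a₁ ≢ pol a₂
    negative    : ∀ a → Minimal _≤A_ a → pol a ≡ neg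

WellOpened : Arena → Set
WellOpened A = Σ M λ a → Minimal _≤A_ a × (∀ a' → Minimal _≤A_ a' → a' ≡ a)
  where open Arena A

record Configuration (A : Arena) (n : ℕ) : Set₁ where
  open Arena A
  field
    _≤x_     : Rel (Fin n) 0ℓ
    isPO     : IsPartialOrder _≡_ _≤x_
    forest   : Forestial _≤x_
    ∂        : Fin n → M
    min-pres : ∀ e → Minimal _≤x_ e → Minimal _≤A_ (∂ e)
    imm-pres : ∀ e₁ e₂ → Imm _≤x_ e₁ e₂ → Imm _≤A_ (∂ e₁) (∂ e₂)

record ConfIso {A : Arena} {n m : ℕ}
               (x : Configuration A n) (y : Configuration A m) : Set where
  open Configuration
  field
    to      : Fin n → Fin m
    from    : Fin m → Fin n
    from-to : ∀ e → from (to e) ≡ e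
    to-from : ∀ e → to (from e) ≡ e
    mono    : ∀ e₁ e₂ → _≤x_ x e₁ e₂ → _≤x_ y (to e₁) (to e₂)
    refl≤   : ∀ e₁ e₂ → _≤x_ y (to e₁) (to e₂) → _≤x_ x e₁ e₂
    disp    : ∀ e → ∂ y (to e) ≡ ∂ x e

record Augmentation (A : Arena) : Set₁ where
  open Arena A
  field
    n     : ℕ                                  -- |q| = Fin n
    D     : Configuration A n
  open Configuration D public using (∂) renaming (_≤x_ to _≤D_)
  polq : Fin n → Pol
  polq e = pol (∂ e)
  field
    _≤q_          : Rel (Fin n) 0ℓ
    isPO          : IsPartialOrder _≡_ _≤q_
    forest        : Forestial _≤q_
    rule-abiding  : ∀ e₁ e₂ → e₁ ≤D e₂ → e₁ ≤q e₂
    courteous     : ∀ e₁ e₂ → Imm _≤q_ e₁ e₂ → (polq e₁ ≡ pos ⊎ polq e₂ ≡ neg)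
                    → Imm _≤D_ e₁ e₂
    deterministic : ∀ e e₁ e₂ → Imm _≤q_ e e₁ → Imm _≤q_ e e₂
                    → polq e₁ ≡ pos → polq e₂ ≡ pos → e₁ ≡ e₂

module _ {A : Arena} (q : Augmentation A) where
  open Augmentation q

  data Chain : Fin n → ℕ → Set where
    one  : ∀ {a} → Chain a 1
    step : ∀ {a a' k} → Imm _≤q_ a a' → Chain a' k → Chain a (suc k)

  IsCoDepth : Fin n → ℕ → Set
  IsCoDepth a k = Chain a k × (∀ k' → Chain a k' → k' ≤ k)

module _ {A : Arena} (q p : Augmentation A) where
  open Augmentation q renaming (n to nq; ∂ to ∂q; polq to pq; _≤q_ to _≤₁_; _≤D_ to _≤D₁_)
  open Augmentation p renaming (n to np; ∂ to ∂p; polq to pp; _≤q_ to _≤₂_; _≤D_ to _≤D₂_)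

  Ctx : Set
  Ctx = List (Fin nq × Fin np)

  InDom : Ctx → Fin nq → Set
  InDom Γ e = Any (λ pr → proj₁ pr ≡ e) Γ

  InCod : Ctx → Fin np → Set
  InCod Γ e = Any (λ pr → proj₂ pr ≡ e) Γ

  IsContext : Ctx → Set
  IsContext Γ =
      (∀ e f → (e , f) ∈ Γ → pq e ≡ neg × ∂q e ≡ ∂p f)
    × (∀ e f f' → (e , f) ∈ Γ → (e , f') ∈ Γ → f ≡ f')
    × (∀ e e' f → (e , f) ∈ Γ → (e' , f) ∈ Γ → e ≡ e')

  _⊢_,_ : Ctx → Fin nq → Fin np → Set
  Γ ⊢ a , b = (∀ e → InDom Γ e → ¬ Lt _≤₁_ a e)
            × (∀ f → InCod Γ f → ¬ Lt _≤₂_ b f)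

  Match : Fin nq → Fin np → (Fin nq → Fin np → Set) → Set
  Match a b R =
      (∀ a' → Imm _≤₁_ a a' → Σ (Fin np) λ b' → Imm _≤₂_ b b' × R a' b')
    × (∀ b' → Imm _≤₂_ b b' → Σ (Fin nq) λ a' → Imm _≤₁_ a a' × R a' b')

  module _ (φ : ConfIso (Augmentation.D q) (Augmentation.D p)) where
    open ConfIso φ using (to)

    -- just(a) is rendered relationally: j is just(a) iff j ≺_{D(q)} a
    data Sim : Ctx → Fin nq → Fin np → Set where
      sim : ∀ {Γ a b}
        → ∂q a ≡ ∂p b
        → Γ ⊢ a , b
        → (pq a ≡ pos → ∀ j j' → Imm _≤D₁_ j a → Imm _≤D₂_ j' b
             → InDom Γ j → (j , j') ∈ Γ)
        → (pq a ≡ pos → ∀ j j' → Imm _≤D₁_ j a → Imm _≤D₂_ j' b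
             → ¬ InDom Γ j → ¬ InCod Γ j' × to j ≡ j')
        → (pq a ≡ pos → Match a b (λ a' b' → Sim ((a' , b') ∷ Γ) a' b'))  -- (1)
        → (pq a ≡ neg → Match a b (Sim Γ))                     -- (2)
        → Sim Γ a b

{-# OPTIONS --safe #-}
module Submission where

-- Co-depth is read off the tree order ≺ alone, and clauses (1)/(2) of a ∼^φ_Γ b
-- say precisely that, once the context Γ is forgotten, ∼ is a back-and-forth
-- relation between the ≺-successors of a and of b.  Such a relation carries
-- every causal chain from a to one of the same length from b and conversely,
-- so the maximal lengths agree.

open import Defs
open import Data.Nat using (ℕ)
open import Data.Fin using (Fin)
open import Data.Product using (Σ; ∃; _×_; _,_; proj₁; proj₂)
open import Function.Base using (flip)
open import Function.Bundles using (_⇔_; mk⇔)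
open import Relation.Binary.PropositionalEquality using (_≡_; refl)

module _ {A : Arena} where
  open Augmentation using (n; _≤q_)

  Forth : (q p : Augmentation A) → (Fin (n q) → Fin (n p) → Set) → Set
  Forth q p R = ∀ {a b} → R a b → ∀ a' → Imm (_≤q_ q) a a'
              → Σ (Fin (n p)) λ b' → Imm (_≤q_ p) b b' × R a' b'

  chain-transfer : ∀ {q p R} → Forth q p R → ∀ {a b k} → R a b → Chain q a k → Chain p b k
  chain-transfer forth r one = one
  chain-transfer forth r (step {a' = a'} a≺a' c) =
    let b' , b≺b' , r' = forth r a' a≺a' in step b≺b' (chain-transfer forth r' c)

  coDepth-transfer : ∀ {q p R} → Forth q p R → Forth p q (flip R)
                   → ∀ {a b} → R a b → ∀ k → IsCoDepth q a k ⇔ IsCoDepth p b k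
  coDepth-transfer forth back r k = mk⇔
    (λ (c , max) → chain-transfer forth r c , λ k' c' → max k' (chain-transfer back r c'))
    (λ (c , max) → chain-transfer back r c , λ k' c' → max k' (chain-transfer forth r c'))

module _ {A : Arena} (q p : Augmentation A)
         (φ : ConfIso (Augmentation.D q) (Augmentation.D p)) where
  open Augmentation q using (polq)

  SimSomeCtx : Fin (Augmentation.n q) → Fin (Augmentation.n p) → Set
  SimSomeCtx a b = ∃ λ Γ → Sim q p φ Γ a b

  Match-map : ∀ {a b} {R R' : Fin (Augmentation.n q) → Fin (Augmentation.n p) → Set}
            → (∀ {a' b'} → R a' b' → R' a' b') → Match q p a b R → Match q p a b R'
  Match-map f (forth , back) =
      (λ a' a≺a' → let b' , b≺b' , r = forth a' a≺a' in b' , b≺b' , f r)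
    , (λ b' b≺b' → let a' , a≺a' , r = back b' b≺b' in a' , a≺a' , f r)

  Sim-match : ∀ {Γ a b} → Sim q p φ Γ a b → Match q p a b SimSomeCtx
  Sim-match {a = a} (sim _ _ _ _ match-pos match-neg) = by-polarity (polq a) refl
    where
    by-polarity : ∀ x → polq a ≡ x → Match q p a _ SimSomeCtx
    by-polarity pos eq = Match-map (_ ,_) (match-pos eq)
    by-polarity neg eq = Match-map (_ ,_) (match-neg eq)

  SimSomeCtx-forth : Forth q p SimSomeCtx
  SimSomeCtx-forth (_ , s) = proj₁ (Sim-match s)

  SimSomeCtx-back : Forth p q (flip SimSomeCtx)
  SimSomeCtx-back (_ , s) = proj₂ (Sim-match s)

lemma53 : (A : Arena) → WellOpened A → (q p : Augmentation A)
    → (φ : ConfIso (Augmentation.D q) (Augmentation.D p))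
    → (Γ : Ctx q p) → IsContext q p Γ
    → (a : Fin (Augmentation.n q)) (b : Fin (Augmentation.n p))
    → Sim q p φ Γ a b
    → (k : ℕ) → IsCoDepth q a k ⇔ IsCoDepth p b k
lemma53 A _ q p φ Γ _ a b s =
  coDepth-transfer (SimSomeCtx-forth q p φ) (SimSomeCtx-back q p φ) (Γ , s)
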